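{- Let $V$ be a set of $8$ vertices, each assigned a number (its label) via $\lambda:V\to\mathbb{N}$, such that each number is the label of at most two vertices. Let $M$ be any set of $4$ pairwise disjoint edges (independent edges) between vertices of $V$, and let $x_1,x_2,x_3,x_4$ be four distinct numbers. Then there is a bijection $g:M\to\{x_1,x_2,x_3,x_4\}$ such that for every edge $e=uw\in M$, $g(e)\ne\lambda(u)$ and $g(e)\ne\lambda(w)$.
   Context: $\mathbb{N}=\{1,2,3,\dots\}$. Edges are unordered pairs of distinct vertices; a set of edges is independent if no two of them share a vertex. -}

module Defs where

open import Data.Nat using (ℕ; _≤_)
open import Data.Fin using (Fin)
open import Data.Product using (_×_; _,_; proj₁; proj₂)
open import Data.Sum using (_⊎_)
open import Relation.Binary.PropositionalEquality using (_≡_; _≢_)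
open import Function.Definitions using (Injective)

V : Set
V = Fin 8

-- An edge: an ordered representation (u , w) of the unordered pair {u , w}, u ≠ w.
Edge : Set
Edge = V × V

IsEdge : Edge → Set
IsEdge (u , w) = u ≢ w

AtMostTwice : (V → ℕ) → Set
AtMostTwice lab = ∀ u v w → lab u ≡ lab v → lab v ≡ lab w → (u ≡ v) ⊎ ((v ≡ w) ⊎ (u ≡ w))

Positive : ℕ → Set
Positive n = 1 ≤ n

Disjoint : Edge → Edge → Set
Disjoint (a , b) (c , d) = (a ≢ c) × (a ≢ d) × (b ≢ c) × (b ≢ d)

Independent4 : (Fin 4 → Edge) → Set
Independent4 e = (∀ i → IsEdge (e i)) × (∀ i j → i ≢ j → Disjoint (e i) (e j))

-- Let B i j hold when x j labels an endpoint of e i.  Since x is injective and each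
-- edge has two endpoints, every row of B has at most two true entries; since each label
-- is used at most twice and the edges are disjoint, so does every column.  The complement
-- of such a 4 × 4 pattern has a perfect matching (Hall's condition: k ≤ 2 rows see at
-- least 2 columns, and k ≥ 3 rows see every column), i.e. a permutation σ with B i (σ i)
-- false for all i; this finite fact is verified by exhaustive enumeration.
module Submission where

open import Defs
open import Data.Bool using (Bool; true; false; T; not; _∧_; _∨_)
open import Data.Bool.ListAction using (all; any)
open import Data.Bool.Properties using (T-∧; T-∨; T-≡)
open import Data.Empty using (⊥-elim)
open import Data.Fin using (Fin; zero; suc; #_; _≟_)
open import Data.Fin.Permutation using (Permutation′; _⟨$⟩ʳ_; id; insert)
open import Data.List using (List; []; _∷_; concatMap; map; allFin)
open import Data.List.Membership.Propositional.Properties using (∈-allFin)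
open import Data.List.Relation.Unary.All as All using ([]; _∷_)
open import Data.List.Relation.Unary.All.Properties using (all⁺; all⁻)
open import Data.List.Relation.Unary.Any using (satisfied)
open import Data.List.Relation.Unary.Any.Properties using (any⁻)
open import Data.Nat using (ℕ; zero; suc; _≡ᵇ_)
open import Data.Nat.Properties using (≡ᵇ⇒≡; ≡⇒≡ᵇ)
open import Data.Product using (Σ; _×_; _,_; proj₁; proj₂)
open import Data.Sum using (_⊎_; inj₁; inj₂; [_,_]) renaming (map to ⊎-map)
open import Data.Vec using (Vec; []; _∷_; lookup; tabulate)
open import Data.Vec.Properties using (lookup∘tabulate)
import Data.Vec.Relation.Unary.All as VecAll
import Data.Vec.Relation.Unary.All.Properties as VecAll
open import Function using (Equivalence; _∘_; flip)
open import Function.Definitions using (Injective)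
open import Relation.Binary.PropositionalEquality using (_≡_; _≢_; refl; sym; trans; subst)
open import Relation.Nullary using (¬_; yes; no)

¬T⇒T-not : ∀ {b} → ¬ T b → T (not b)
¬T⇒T-not {true}  ¬b = ¬b _
¬T⇒T-not {false} _  = _

T-not⇒¬T : ∀ {b} → T (not b) → ¬ T b
T-not⇒¬T {true}  ()

∧-intro : ∀ {a b} → T a → T b → T (a ∧ b)
∧-intro a b = Equivalence.from T-∧ (a , b)

Bool-pigeonhole : (a b c : Bool) → a ≡ b ⊎ b ≡ c ⊎ a ≡ c
Bool-pigeonhole false false _     = inj₁ refl
Bool-pigeonhole true  true  _     = inj₁ refl
Bool-pigeonhole false true  false = inj₂ (inj₂ refl)
Bool-pigeonhole false true  true  = inj₂ (inj₁ refl)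
Bool-pigeonhole true  false false = inj₂ (inj₁ refl)
Bool-pigeonhole true  false true  = inj₂ (inj₂ refl)

AtMostTwoTrue : ∀ {n} → (Fin n → Bool) → Set
AtMostTwoTrue f = ∀ i j k → T (f i) → T (f j) → T (f k) → i ≡ j ⊎ j ≡ k ⊎ i ≡ k

noThreeTrue : (Fin 4 → Bool) → Fin 4 → Fin 4 → Fin 4 → Bool
noThreeTrue f i j k = not (f i ∧ f j ∧ f k)

atMostTwoTrue : (Fin 4 → Bool) → Bool
atMostTwoTrue f = noThreeTrue f (# 0) (# 1) (# 2) ∧ noThreeTrue f (# 0) (# 1) (# 3) ∧
                  noThreeTrue f (# 0) (# 2) (# 3) ∧ noThreeTrue f (# 1) (# 2) (# 3)

AtMostTwoTrue⇒atMostTwoTrue : ∀ f → AtMostTwoTrue f → T (atMostTwoTrue f)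
AtMostTwoTrue⇒atMostTwoTrue f two =
  ∧-intro (noThree (# 0) (# 1) (# 2) (λ ()) (λ ()) (λ ()))
  (∧-intro (noThree (# 0) (# 1) (# 3) (λ ()) (λ ()) (λ ()))
  (∧-intro (noThree (# 0) (# 2) (# 3) (λ ()) (λ ()) (λ ()))
           (noThree (# 1) (# 2) (# 3) (λ ()) (λ ()) (λ ()))))
  where
  noThree : ∀ i j k → i ≢ j → j ≢ k → i ≢ k → T (noThreeTrue f i j k)
  noThree i j k i≢j j≢k i≢k = ¬T⇒T-not λ fijk →
    let fi , fjk = Equivalence.to (T-∧ {f i}) fijk
        fj , fk  = Equivalence.to (T-∧ {f j}) fjk
    in [ i≢j , [ j≢k , i≢k ] ] (two i j k fi fj fk)

permutations : ∀ n → List (Permutation′ n)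
permutations zero    = id ∷ []
permutations (suc n) = concatMap (λ j → map (insert zero j) (permutations n)) (allFin (suc n))

Matrix : Set
Matrix = Vec (Vec Bool 4) 4

entry : Matrix → Fin 4 → Fin 4 → Bool
entry M i j = lookup (lookup M i) j

avoids : Matrix → Permutation′ 4 → Bool
avoids M σ = all (λ i → not (entry M i (σ ⟨$⟩ʳ i))) (allFin 4)

allVec : ∀ n → (Vec Bool n → Bool) → Bool
allVec zero    p = p []
allVec (suc n) p = allVec n (p ∘ (false ∷_)) ∧ allVec n (p ∘ (true ∷_))

allVec-sound : ∀ n p → T (allVec n p) → ∀ v → T (p v)
allVec-sound zero    p t [] = t
allVec-sound (suc n) p t (b ∷ v)
  with Equivalence.to (T-∧ {allVec n (p ∘ (false ∷_))} {allVec n (p ∘ (true ∷_))}) t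
allVec-sound (suc n) p t (false ∷ v) | f , _ = allVec-sound n (p ∘ (false ∷_)) f v
allVec-sound (suc n) p t (true ∷ v)  | _ , t′ = allVec-sound n (p ∘ (true ∷_)) t′ v

_⇒_ : Bool → Bool → Bool
true  ⇒ b = b
false ⇒ _ = true

⇒-elim : ∀ {a b} → T (a ⇒ b) → T a → T b
⇒-elim {true} t _ = t

-- The sparsity test on each row is applied before the next row is enumerated, so only
-- 11⁴ of the 2¹⁶ candidate matrices are examined further.
forSparseMatrices : ∀ m → (Vec (Vec Bool 4) m → Bool) → Bool
forSparseMatrices zero    p = p []
forSparseMatrices (suc m) p = allVec 4 λ r → atMostTwoTrue (lookup r) ⇒ forSparseMatrices m (p ∘ (r ∷_))

forSparseMatrices-sound : ∀ m p → forSparseMatrices m p ≡ true →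
                          ∀ M → VecAll.All (T ∘ atMostTwoTrue ∘ lookup) M → T (p M)
forSparseMatrices-sound zero    p eq []      VecAll.[]         = Equivalence.from T-≡ eq
forSparseMatrices-sound (suc m) p eq (r ∷ M) (s VecAll.∷ ss) =
  forSparseMatrices-sound m (p ∘ (r ∷_)) (Equivalence.to T-≡ remainingRows) M ss
  where
  rowStep : Vec Bool 4 → Bool
  rowStep r′ = atMostTwoTrue (lookup r′) ⇒ forSparseMatrices m (p ∘ (r′ ∷_))

  remainingRows : T (forSparseMatrices m (p ∘ (r ∷_)))
  remainingRows = ⇒-elim (allVec-sound 4 rowStep (Equivalence.from T-≡ eq) r) s

columnsSparse : Matrix → Bool
columnsSparse M = all (λ j → atMostTwoTrue (λ i → entry M i j)) (allFin 4)

avoidableIfColumnsSparse : Matrix → Bool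
avoidableIfColumnsSparse M = columnsSparse M ⇒ any (avoids M) (permutations 4)

-- Stated as an equation rather than as T b: Agda normalises b whenever a term is checked
-- against T b, which would redo the whole enumeration at every use.
sparseMatricesAreAvoidable : forSparseMatrices 4 avoidableIfColumnsSparse ≡ true
sparseMatricesAreAvoidable = refl

avoiding-permutation : (B : Fin 4 → Fin 4 → Bool) →
                       (∀ i → AtMostTwoTrue (B i)) → (∀ j → AtMostTwoTrue (flip B j)) →
                       Σ (Permutation′ 4) λ σ → ∀ i → ¬ T (B i (σ ⟨$⟩ʳ i))
avoiding-permutation B rows cols = σ , λ i → T-not⇒¬T (subst (T ∘ not) (entry-M i (σ ⟨$⟩ʳ i)) (avoid-at i))
  where
  M : Matrix
  M = tabulate (tabulate ∘ B)

  entry-M : ∀ i j → entry M i j ≡ B i j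
  entry-M i j rewrite lookup∘tabulate (tabulate ∘ B) i = lookup∘tabulate (B i) j

  avoidable : T (avoidableIfColumnsSparse M)
  avoidable = forSparseMatrices-sound 4 avoidableIfColumnsSparse sparseMatricesAreAvoidable M
                (VecAll.tabulate⁺ {P = T ∘ atMostTwoTrue ∘ lookup} {f = tabulate ∘ B}
                  λ i → AtMostTwoTrue⇒atMostTwoTrue (B i) (rows i))

  -- Listed at concrete j, where entry M i j computes to B i j.
  columns : T (columnsSparse M)
  columns = all⁻ (λ j → atMostTwoTrue (λ i → entry M i j)) {allFin 4}
              (column (# 0) ∷ column (# 1) ∷ column (# 2) ∷ column (# 3) ∷ [])
    where
    column : ∀ j → T (atMostTwoTrue (flip B j))
    column j = AtMostTwoTrue⇒atMostTwoTrue (flip B j) (cols j)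

  found : Σ (Permutation′ 4) (T ∘ avoids M)
  found = satisfied (any⁻ (avoids M) (permutations 4)
            (⇒-elim {columnsSparse M} {any (avoids M) (permutations 4)} avoidable columns))

  σ : Permutation′ 4
  σ = proj₁ found

  avoid-at : ∀ i → T (not (entry M i (σ ⟨$⟩ʳ i)))
  avoid-at i = All.lookup (all⁺ (λ i → not (entry M i (σ ⟨$⟩ʳ i))) (allFin 4) (proj₂ found)) (∈-allFin i)

endpoint : Edge → Bool → V
endpoint (u , _) true  = u
endpoint (_ , w) false = w

Disjoint⇒endpoint-distinct : ∀ {d d′} → Disjoint d d′ → ∀ s s′ → endpoint d s ≢ endpoint d′ s′
Disjoint⇒endpoint-distinct {_ , _} {_ , _} (u≢u′ , _ , _ , _) true  true  = u≢u′
Disjoint⇒endpoint-distinct {_ , _} {_ , _} (_ , u≢w′ , _ , _) true  false = u≢w′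
Disjoint⇒endpoint-distinct {_ , _} {_ , _} (_ , _ , w≢u′ , _) false true  = w≢u′
Disjoint⇒endpoint-distinct {_ , _} {_ , _} (_ , _ , _ , w≢w′) false false = w≢w′

endpoint-injective : ∀ {e} → Independent4 e → ∀ {i i′} s s′ → endpoint (e i) s ≡ endpoint (e i′) s′ → i ≡ i′
endpoint-injective (_ , disjoint) {i} {i′} s s′ eq with i ≟ i′
... | yes i≡i′ = i≡i′
... | no  i≢i′ = ⊥-elim (Disjoint⇒endpoint-distinct (disjoint i i′ i≢i′) s s′ eq)

labelsEndpoint : (V → ℕ) → Edge → ℕ → Bool
labelsEndpoint lab (u , w) n = (n ≡ᵇ lab u) ∨ (n ≡ᵇ lab w)

labelsEndpoint⇒ : ∀ lab d n → T (labelsEndpoint lab d n) → Σ Bool λ s → n ≡ lab (endpoint d s)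
labelsEndpoint⇒ lab (u , w) n t with Equivalence.to (T-∨ {n ≡ᵇ lab u}) t
... | inj₁ n≡u = true  , ≡ᵇ⇒≡ n (lab u) n≡u
... | inj₂ n≡w = false , ≡ᵇ⇒≡ n (lab w) n≡w

¬labelsEndpoint⇒ : ∀ lab d n → ¬ T (labelsEndpoint lab d n) → n ≢ lab (proj₁ d) × n ≢ lab (proj₂ d)
¬labelsEndpoint⇒ lab (u , w) n ¬t =
  (λ n≡u → ¬t (Equivalence.from T-∨ (inj₁ (≡⇒≡ᵇ n (lab u) n≡u)))) ,
  (λ n≡w → ¬t (Equivalence.from (T-∨ {n ≡ᵇ lab u}) (inj₂ (≡⇒≡ᵇ n (lab w) n≡w))))

injective⇒AtMostTwoTrue-labelsEndpoint : ∀ lab d {n} (x : Fin n → ℕ) → Injective _≡_ _≡_ x →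
                                         AtMostTwoTrue (labelsEndpoint lab d ∘ x)
injective⇒AtMostTwoTrue-labelsEndpoint lab d x inj j k l tj tk tl
  with labelsEndpoint⇒ lab d (x j) tj | labelsEndpoint⇒ lab d (x k) tk | labelsEndpoint⇒ lab d (x l) tl
... | s₁ , p₁ | s₂ , p₂ | s₃ , p₃ =
  ⊎-map (same p₁ p₂) (⊎-map (same p₂ p₃) (same p₁ p₃)) (Bool-pigeonhole s₁ s₂ s₃)
  where
  same : ∀ {a b s s′} → x a ≡ lab (endpoint d s) → x b ≡ lab (endpoint d s′) → s ≡ s′ → a ≡ b
  same p q refl = inj (trans p (sym q))

atMostTwice⇒AtMostTwoTrue-labelsEndpoint : ∀ {lab} → AtMostTwice lab → ∀ {e} → Independent4 e →
                                           ∀ n → AtMostTwoTrue (λ i → labelsEndpoint lab (e i) n)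
atMostTwice⇒AtMostTwoTrue-labelsEndpoint {lab} twice {e} independent n i₁ i₂ i₃ t₁ t₂ t₃
  with labelsEndpoint⇒ lab (e i₁) n t₁ | labelsEndpoint⇒ lab (e i₂) n t₂ | labelsEndpoint⇒ lab (e i₃) n t₃
... | s₁ , p₁ | s₂ , p₂ | s₃ , p₃ =
  ⊎-map (same s₁ s₂) (⊎-map (same s₂ s₃) (same s₁ s₃)) (twice _ _ _ (trans (sym p₁) p₂) (trans (sym p₂) p₃))
  where
  same : ∀ {i i′} s s′ → endpoint (e i) s ≡ endpoint (e i′) s′ → i ≡ i′
  same = endpoint-injective independent

lemma5 : (lab : V → ℕ) → (∀ v → Positive (lab v)) → AtMostTwice lab →
         (e : Fin 4 → Edge) → Independent4 e →
         (x : Fin 4 → ℕ) → (∀ i → Positive (x i)) → Injective _≡_ _≡_ x →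
         Σ (Permutation′ 4) λ σ →
           ∀ i → (x (σ ⟨$⟩ʳ i) ≢ lab (proj₁ (e i))) × (x (σ ⟨$⟩ʳ i) ≢ lab (proj₂ (e i)))
lemma5 lab _ twice e independent x _ injective =
  let σ , avoiding = avoiding-permutation (λ i j → labelsEndpoint lab (e i) (x j))
                     (λ i → injective⇒AtMostTwoTrue-labelsEndpoint lab (e i) x injective)
                     (λ j → atMostTwice⇒AtMostTwoTrue-labelsEndpoint twice independent (x j))
  in σ , λ i → ¬labelsEndpoint⇒ lab (e i) (x (σ ⟨$⟩ʳ i)) (avoiding i)
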